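{- For all integers $n\ge 2$ and $m\ge 1$, $\mathrm{R}_{\mathbb{B}}(C_n\otimes C_m)\ge \frac{n(n-1)}{\lceil n/2\rceil\cdot\lfloor n/2\rfloor}\cdot\sigma(m)$. In particular, $\mathrm{R}_{\mathbb{B}}(C_n\otimes C_n)\ge (4-o(1))\cdot\sigma(n)$ as $n\to\infty$.
   Context: $C_n$ denotes the $n\times n$ $0,1$-matrix with zeros on the diagonal and ones everywhere else. $\sigma(n)=\min\{k : n\le\binom{k}{\lceil k/2\rceil}\}$. The Boolean rank $\mathrm{R}_{\mathbb{B}}(A)$ of a $0,1$-matrix $A$ is the smallest number of all-ones combinatorial rectangles needed to cover all $1$-entries of $A$. The Kronecker product $A\otimes B$ is the block matrix whose $(i,j)$-th block is $A_{i,j}\cdot B$. -}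

module Defs where

open import Data.Nat using (ℕ; _*_; _≤_; _<_; ⌈_/2⌉)
open import Data.Nat.Combinatorics using (_C_)
open import Data.Bool using (Bool; true; false; not; _∧_)
open import Data.Fin using (Fin; remQuot)
open import Data.Fin.Properties using (_≟_)
open import Data.Product using (_×_; _,_; Σ)
open import Relation.Binary.PropositionalEquality using (_≡_)
open import Relation.Nullary.Decidable using (⌊_⌋)

Matrix : ℕ → ℕ → Set
Matrix r c = Fin r → Fin c → Bool

Cmat : (n : ℕ) → Matrix n n
Cmat n i j = not ⌊ i ≟ j ⌋

-- Row index of A ⊗ B in Fin (r₁ * r₂) is decoded as (block row, row inside block)
-- via remQuot, the inverse of combine i k = i * r₂ + k.
_⊗_ : ∀ {r₁ c₁ r₂ c₂} → Matrix r₁ c₁ → Matrix r₂ c₂ → Matrix (r₁ * r₂) (c₁ * c₂)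
_⊗_ {r₁} {c₁} {r₂} {c₂} A B x y with remQuot {r₁} r₂ x | remQuot {c₁} c₂ y
... | i , k | j , l = A i j ∧ B k l

record Rectangle (r c : ℕ) : Set where
  constructor rect
  field
    rows : Fin r → Bool
    cols : Fin c → Bool
open Rectangle public

AllOnes : ∀ {r c} → Matrix r c → Rectangle r c → Set
AllOnes A R = ∀ i j → rows R i ≡ true → cols R j ≡ true → A i j ≡ true

record Cover {r c : ℕ} (A : Matrix r c) (k : ℕ) : Set where
  field
    rect-of  : Fin k → Rectangle r c
    all-ones : ∀ t → AllOnes A (rect-of t)
    covers   : ∀ i j → A i j ≡ true →
               Σ (Fin k) λ t → (rows (rect-of t) i ≡ true) × (cols (rect-of t) j ≡ true)

-- R_B(A) ≥ b : every cover of A uses at least b rectangles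
-- (equivalent to the minimum cover size being ≥ b).
-- The theorem quantifies over all covers and cross-multiplies the rational bound.

IsSigma : ℕ → ℕ → Set
IsSigma m s = (m ≤ s C ⌈ s /2⌉) × (∀ k → k < s → k C ⌈ k /2⌉ < m)

-- Fix a cover of C_n ⊗ C_m by k rectangles and look at it blockwise.  A rectangle
-- R meets block (i, j) if some row of block-row i and some column of block-column j
-- lie in R.  Since the diagonal blocks are zero, the block rows and block columns
-- met by R are disjoint sets of sizes x, y with x + y ≤ n, so R meets at most
-- x y ≤ ⌈n/2⌉⌊n/2⌋ blocks.  Conversely, in an off-diagonal block (i, j) let U be
-- the set of rectangles meeting it and, for each row a of C_m, let S_a be the
-- rectangles of U containing row a of block-row i.  The entry (a, b) with a ≠ b of the
-- block is covered by a rectangle in S_a that cannot lie in S_b, since it would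
-- then contain the zero entry (b, b).  So the S_a form an antichain of m sets in U,
-- and Sperner's theorem gives m ≤ C(|U|, ⌈|U|/2⌉), i.e. |U| ≥ σ(m).  Counting the
-- pairs (rectangle, off-diagonal block it meets) in both ways gives the bound.
-- Sperner's theorem is proved through the LYM inequality, by induction on |U|.
module Submission where

open import Algebra.Properties.CommutativeSemigroup using (x∙yz≈y∙xz)
open import Data.Bool using (Bool; true; false; not; _∧_)
import Data.Bool.Properties as Bool
open import Data.Empty using (⊥; ⊥-elim)
open import Data.Fin using (Fin; zero; suc; combine; punchIn)
open import Data.Fin.Properties using (_≟_; any?; remQuot-combine; punchInᵢ≢i; suc-injective; 0≢1+n)
open import Data.Nat using (ℕ; zero; suc; _+_; _*_; _∸_; _≤_; _<_; _≤′_; ≤′-refl; ≤′-step; z≤n; s≤s; s≤s⁻¹; _/_; _!; ⌈_/2⌉; ⌊_/2⌋)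
open import Data.Nat.Combinatorics using (_C_; nCk≡n!/k![n-k]!; k![n∸k]!∣n!; [n-k]*d[k+1]≡[k+1]*d[k]; [n-k]*[n-k-1]!≡[n-k]!)
open import Data.Nat.DivMod using (m/n*n≡m)
open import Data.Nat.Divisibility using (∣⇒≤)
open import Data.Nat.Properties hiding (_≟_; suc-injective; 0≢1+n)
import Data.Nat.Properties as ℕ
open import Algebra.Properties.Semiring.Sum +-*-semiring
  using (sum; sum-syntax; sum-cong-≗; sum-replicate-zero; sum-remove; ∑-comm; ∑-distrib-+; *-distribˡ-sum; *-distribʳ-sum)
open import Data.Nat.Solver using (module +-*-Solver)
open import Data.Product using (_,_; proj₁; proj₂)
open import Data.Sum using (inj₁; inj₂)
open import Function using (_∘_)
open import Relation.Binary.PropositionalEquality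
open import Relation.Nullary using (Dec; yes; no; ¬_; _×-dec_)
open import Relation.Nullary.Decidable using (⌊_⌋)

open import Defs

open ≤-Reasoning

⌊⌋-true : ∀ {p} {P : Set p} (P? : Dec P) → P → ⌊ P? ⌋ ≡ true
⌊⌋-true (yes _) _ = refl
⌊⌋-true (no ¬p) p = ⊥-elim (¬p p)

⌊⌋-false : ∀ {p} {P : Set p} (P? : Dec P) → ¬ P → ⌊ P? ⌋ ≡ false
⌊⌋-false (yes p) ¬p = ⊥-elim (¬p p)
⌊⌋-false (no _)  _  = refl

witness : ∀ {p} {P : Set p} (P? : Dec P) → ⌊ P? ⌋ ≡ true → P
witness (yes p) _ = p

true≢false : true ≢ false
true≢false ()

∧-intro : ∀ {a b} → a ≡ true → b ≡ true → a ∧ b ≡ true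
∧-intro refl refl = refl

∧-elimˡ : ∀ a {b} → a ∧ b ≡ true → a ≡ true
∧-elimˡ true _ = refl

∧-elimʳ : ∀ a {b} → a ∧ b ≡ true → b ≡ true
∧-elimʳ true e = e

⟦_⟧ : Bool → ℕ
⟦ true ⟧  = 1
⟦ false ⟧ = 0

⟦∧⟧ : ∀ a b → ⟦ a ∧ b ⟧ ≡ ⟦ a ⟧ * ⟦ b ⟧
⟦∧⟧ true  b = sym (+-identityʳ ⟦ b ⟧)
⟦∧⟧ false b = refl

sum-mono : ∀ {n} {f g : Fin n → ℕ} → (∀ i → f i ≤ g i) → sum f ≤ sum g
sum-mono {zero}  f≤g = z≤n
sum-mono {suc n} f≤g = +-mono-≤ (f≤g zero) (sum-mono (f≤g ∘ suc))

sum-const : ∀ n c → ∑[ i < n ] c ≡ n * c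
sum-const zero    c = refl
sum-const (suc n) c = cong (c +_) (sum-const n c)

sum-zero : ∀ {n} {f : Fin n → ℕ} → (∀ i → f i ≡ 0) → sum f ≡ 0
sum-zero {n} f≗0 = trans (sum-cong-≗ f≗0) (sum-replicate-zero n)

term≤sum : ∀ {n} (f : Fin n → ℕ) i → f i ≤ sum f
term≤sum {suc n} f i = ≤-trans (m≤m+n (f i) _) (≤-reflexive (sym (sum-remove {i = i} f)))

sum-≤-at-most-one : ∀ {m c} (sel : Fin m → Bool) (g : Fin m → ℕ) →
                    (∀ {a b} → sel a ≡ true → sel b ≡ true → a ≡ b) →
                    (∀ {a} → sel a ≡ true → g a ≤ c) →
                    ∑[ a < m ] (⟦ sel a ⟧ * g a) ≤ c
sum-≤-at-most-one {zero} sel g unique bound = z≤n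
sum-≤-at-most-one {suc m} {c} sel g unique bound with sel zero in sel₀
... | false = sum-≤-at-most-one (sel ∘ suc) (g ∘ suc) (λ p q → suc-injective (unique p q)) bound
... | true  = begin
  g zero + 0 + ∑[ a < m ] (⟦ sel (suc a) ⟧ * g (suc a)) ≡⟨ cong₂ _+_ (+-identityʳ (g zero)) (sum-zero unselected) ⟩
  g zero + 0                                           ≡⟨ +-identityʳ (g zero) ⟩
  g zero                                               ≤⟨ bound sel₀ ⟩
  c                                                    ∎
  where
  unselected : ∀ a → ⟦ sel (suc a) ⟧ * g (suc a) ≡ 0
  unselected a with sel (suc a) in selₐ
  ... | false = refl
  ... | true  = ⊥-elim (0≢1+n (unique sel₀ selₐ))

Subset : ℕ → Set
Subset n = Fin n → Bool

infix  4 _⊆_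
infixr 7 _∩_
infixl 6 _∖_

∣_∣ : ∀ {n} → Subset n → ℕ
∣_∣ {n} P = ∑[ x < n ] ⟦ P x ⟧

_⊆_ : ∀ {n} → Subset n → Subset n → Set
P ⊆ Q = ∀ x → P x ≡ true → Q x ≡ true

_∩_ : ∀ {n} → Subset n → Subset n → Subset n
(P ∩ Q) x = P x ∧ Q x

_∖_ : ∀ {n} → Subset n → Subset n → Subset n
(P ∖ Q) x = P x ∧ not (Q x)

⁅_⁆ : ∀ {n} → Fin n → Subset n
⁅ x ⁆ y = ⌊ x ≟ y ⌋

∣∣-split : ∀ {n} (P Q : Subset n) → ∣ P ∣ ≡ ∣ P ∩ Q ∣ + ∣ P ∖ Q ∣
∣∣-split P Q = trans (sum-cong-≗ (λ x → split (P x) (Q x))) (∑-distrib-+ (λ x → ⟦ P x ∧ Q x ⟧) (λ x → ⟦ P x ∧ not (Q x) ⟧))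
  where
  split : ∀ p q → ⟦ p ⟧ ≡ ⟦ p ∧ q ⟧ + ⟦ p ∧ not q ⟧
  split true  true  = refl
  split true  false = refl
  split false q     = refl

∣∣-diff : ∀ {n} {A B : Subset n} → A ⊆ B → ∣ B ∣ ≡ ∣ A ∣ + ∣ B ∖ A ∣
∣∣-diff {A = A} {B} A⊆B = trans (∣∣-split B A) (cong (_+ ∣ B ∖ A ∣) (sum-cong-≗ (cong ⟦_⟧ ∘ B∩A≗A)))
  where
  B∩A≗A : ∀ x → B x ∧ A x ≡ A x
  B∩A≗A x with A x in Ax
  ... | true  = cong (_∧ true) (A⊆B x Ax)
  ... | false = Bool.∧-zeroʳ (B x)

∣∣-mono : ∀ {n} {A B : Subset n} → A ⊆ B → ∣ A ∣ ≤ ∣ B ∣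
∣∣-mono A⊆B = ≤-trans (m≤m+n _ _) (≤-reflexive (sym (∣∣-diff A⊆B)))

∈⇒∣∣>0 : ∀ {n} {P : Subset n} {x} → P x ≡ true → 0 < ∣ P ∣
∈⇒∣∣>0 {P = P} {x} Px = ≤-trans (≤-reflexive (cong ⟦_⟧ (sym Px))) (term≤sum (⟦_⟧ ∘ P) x)

⊆∧∣∣≤⇒⊇ : ∀ {n} {A B : Subset n} → A ⊆ B → ∣ B ∣ ≤ ∣ A ∣ → B ⊆ A
⊆∧∣∣≤⇒⊇ {A = A} {B} A⊆B ∣B∣≤∣A∣ x Bx with A x in Ax
... | true  = refl
... | false = ⊥-elim (<⇒≱ ∣A∣<∣B∣ ∣B∣≤∣A∣)
  where
  ∣A∣<∣B∣ : ∣ A ∣ < ∣ B ∣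
  ∣A∣<∣B∣ = begin-strict
    ∣ A ∣             <⟨ m<m+n ∣ A ∣ (∈⇒∣∣>0 {P = B ∖ A} (cong₂ (λ b a → b ∧ not a) Bx Ax)) ⟩
    ∣ A ∣ + ∣ B ∖ A ∣ ≡⟨ ∣∣-diff A⊆B ⟨
    ∣ B ∣             ∎

∣⁅x⁆∣≡1 : ∀ {n} (x : Fin n) → ∣ ⁅ x ⁆ ∣ ≡ 1
∣⁅x⁆∣≡1 {suc n} x = begin-equality
  ∣ ⁅ x ⁆ ∣                                         ≡⟨ sum-remove {i = x} (⟦_⟧ ∘ ⁅ x ⁆) ⟩
  ⟦ ⁅ x ⁆ x ⟧ + ∑[ j < n ] ⟦ ⁅ x ⁆ (punchIn x j) ⟧ ≡⟨ cong₂ _+_ (cong ⟦_⟧ (⌊⌋-true (x ≟ x) refl)) (sum-zero others) ⟩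
  1                                                 ∎
  where
  others : ∀ j → ⟦ ⁅ x ⁆ (punchIn x j) ⟧ ≡ 0
  others j = cong ⟦_⟧ (⌊⌋-false (x ≟ punchIn x j) (punchInᵢ≢i x j ∘ sym))

∣∣-remove : ∀ {n} {P : Subset n} {x} → P x ≡ true → ∣ P ∣ ≡ suc ∣ P ∖ ⁅ x ⁆ ∣
∣∣-remove {P = P} {x} Px = trans (∣∣-diff ⁅x⁆⊆P) (cong (_+ ∣ P ∖ ⁅ x ⁆ ∣) (∣⁅x⁆∣≡1 x))
  where
  ⁅x⁆⊆P : ⁅ x ⁆ ⊆ P
  ⁅x⁆⊆P y x≡y = subst (λ z → P z ≡ true) (witness (x ≟ y) x≡y) Px

⊆∖⁅⁆ : ∀ {n} {A U : Subset n} {x} → A ⊆ U → not (A x) ≡ true → A ⊆ U ∖ ⁅ x ⁆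
⊆∖⁅⁆ {x = x} A⊆U x∉A y y∈A with x ≟ y
... | no  _    = cong (_∧ true) (A⊆U y y∈A)
... | yes refl = ⊥-elim (true≢false (trans (sym x∉A) (cong not y∈A)))

∣∣+∣∣≤n : ∀ {n} {P Q : Subset n} → (∀ x → P x ≡ true → Q x ≡ true → ⊥) → ∣ P ∣ + ∣ Q ∣ ≤ n
∣∣+∣∣≤n {n} {P} {Q} disjoint = begin
  ∣ P ∣ + ∣ Q ∣                  ≡⟨ ∑-distrib-+ (⟦_⟧ ∘ P) (⟦_⟧ ∘ Q) ⟨
  ∑[ x < n ] (⟦ P x ⟧ + ⟦ Q x ⟧) ≤⟨ sum-mono at-most-one ⟩
  ∑[ x < n ] 1                   ≡⟨ sum-const n 1 ⟩
  n * 1                          ≡⟨ *-identityʳ n ⟩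
  n                              ∎
  where
  at-most-one : ∀ x → ⟦ P x ⟧ + ⟦ Q x ⟧ ≤ 1
  at-most-one x with P x in Px | Q x in Qx
  ... | true  | true  = ⊥-elim (disjoint x Px Qx)
  ... | true  | false = ≤-refl
  ... | false | true  = ≤-refl
  ... | false | false = z≤n

∑∑⟦∧⟧≡∣∣*∣∣ : ∀ {r c} (P : Subset r) (Q : Subset c) →
              ∑[ i < r ] ∑[ j < c ] ⟦ P i ∧ Q j ⟧ ≡ ∣ P ∣ * ∣ Q ∣
∑∑⟦∧⟧≡∣∣*∣∣ {r} {c} P Q = begin-equality
  ∑[ i < r ] ∑[ j < c ] ⟦ P i ∧ Q j ⟧       ≡⟨ sum-cong-≗ (λ i → sum-cong-≗ (λ j → ⟦∧⟧ (P i) (Q j))) ⟩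
  ∑[ i < r ] ∑[ j < c ] (⟦ P i ⟧ * ⟦ Q j ⟧) ≡⟨ sum-cong-≗ (λ i → *-distribˡ-sum ⟦ P i ⟧ (⟦_⟧ ∘ Q)) ⟨
  ∑[ i < r ] (⟦ P i ⟧ * ∣ Q ∣)             ≡⟨ *-distribʳ-sum ∣ Q ∣ (⟦_⟧ ∘ P) ⟨
  ∣ P ∣ * ∣ Q ∣                             ∎

x+y≤n⇒x*y≤⌈n/2⌉*⌊n/2⌋ : ∀ n {x y} → x + y ≤ n → x * y ≤ ⌈ n /2⌉ * ⌊ n /2⌋
x+y≤n⇒x*y≤⌈n/2⌉*⌊n/2⌋ n {zero}          _  = z≤n
x+y≤n⇒x*y≤⌈n/2⌉*⌊n/2⌋ n {suc x} {zero}  _  = ≤-trans (≤-reflexive (*-zeroʳ (suc x))) z≤n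
x+y≤n⇒x*y≤⌈n/2⌉*⌊n/2⌋ n {suc x} {suc y} le with ≤-trans (≤-reflexive (cong suc (sym (+-suc x y)))) le
... | s≤s (s≤s {n = n′} x+y≤n′) = begin
  suc x * suc y                                   ≡⟨ expand x y ⟩
  suc (x + y + x * y)                             ≤⟨ s≤s (+-mono-≤ x+y≤⌈⌉+⌊⌋ x*y≤⌈⌉*⌊⌋) ⟩
  suc (⌈ n′ /2⌉ + ⌊ n′ /2⌋ + ⌈ n′ /2⌉ * ⌊ n′ /2⌋) ≡⟨ expand ⌈ n′ /2⌉ ⌊ n′ /2⌋ ⟨
  suc ⌈ n′ /2⌉ * suc ⌊ n′ /2⌋                     ∎
  where
  open +-*-Solver
  expand : ∀ a b → suc a * suc b ≡ suc (a + b + a * b)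
  expand = solve 2 (λ a b → (con 1 :+ a) :* (con 1 :+ b) := con 1 :+ (a :+ b :+ a :* b)) refl
  x+y≤⌈⌉+⌊⌋ : x + y ≤ ⌈ n′ /2⌉ + ⌊ n′ /2⌋
  x+y≤⌈⌉+⌊⌋ = ≤-trans x+y≤n′ (≤-reflexive (sym (trans (+-comm ⌈ n′ /2⌉ ⌊ n′ /2⌋) (⌊n/2⌋+⌈n/2⌉≡n n′))))
  x*y≤⌈⌉*⌊⌋ : x * y ≤ ⌈ n′ /2⌉ * ⌊ n′ /2⌋
  x*y≤⌈⌉*⌊⌋ = x+y≤n⇒x*y≤⌈n/2⌉*⌊n/2⌋ n′ {x} {y} x+y≤n′

antitone-below : ∀ (f : ℕ → ℕ) {h j} → (∀ {i} → suc i ≤ h → f (suc i) ≤ f i) → j ≤′ h → f h ≤ f j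
antitone-below f step ≤′-refl       = ≤-refl
antitone-below f step (≤′-step j≤h) =
  ≤-trans (step ≤-refl) (antitone-below f (step ∘ m≤n⇒m≤1+n) j≤h)

monotone-above : ∀ (f : ℕ → ℕ) {h j u} → (∀ {i} → h ≤ i → i < u → f i ≤ f (suc i)) →
                 h ≤′ j → j ≤ u → f h ≤ f j
monotone-above f step ≤′-refl       j≤u = ≤-refl
monotone-above f step (≤′-step h≤j) j≤u =
  ≤-trans (monotone-above f step h≤j (≤-trans (n≤1+n _) j≤u)) (step (≤′⇒≤ h≤j) j≤u)

⌈n/2⌉≤1+⌊n/2⌋ : ∀ n → ⌈ n /2⌉ ≤ suc ⌊ n /2⌋
⌈n/2⌉≤1+⌊n/2⌋ zero          = z≤n
⌈n/2⌉≤1+⌊n/2⌋ (suc zero)    = ≤-refl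
⌈n/2⌉≤1+⌊n/2⌋ (suc (suc n)) = s≤s (⌈n/2⌉≤1+⌊n/2⌋ n)

-- weight u j = u ! / (u C j) is the number of maximal chains of a u-set through a
-- fixed j-subset.
weight : ℕ → ℕ → ℕ
weight u j = j ! * (u ∸ j) !

weight≤factorial : ∀ {u j} → j ≤ u → weight u j ≤ u !
weight≤factorial {u} j≤u = ∣⇒≤ {{u !≢0}} (k![n∸k]!∣n! j≤u)

factorial≡C*weight : ∀ {u j} → j ≤ u → u ! ≡ (u C j) * weight u j
factorial≡C*weight {u} {j} j≤u = sym (begin-equality
  (u C j) * weight u j            ≡⟨ cong (_* weight u j) (nCk≡n!/k![n-k]! j≤u) ⟩
  (u ! / weight u j) * weight u j ≡⟨ m/n*n≡m (k![n∸k]!∣n! j≤u) ⟩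
  u !                             ∎)
  where instance _ = j !* (u ∸ j) !≢0

weight-suc : ∀ {u j} → j ≤ u → weight (suc u) j ≡ (suc u ∸ j) * weight u j
weight-suc {u} {j} j≤u = begin-equality
  j ! * (suc u ∸ j) !                 ≡⟨ cong (j ! *_) ([n-k]*[n-k-1]!≡[n-k]! (s≤s j≤u)) ⟨
  j ! * ((suc u ∸ j) * (u ∸ j) !)     ≡⟨ x∙yz≈y∙xz *-commutativeSemigroup (j !) (suc u ∸ j) ((u ∸ j) !) ⟩
  (suc u ∸ j) * weight u j            ∎

weight-antitone : ∀ {u j} → suc j ≤ ⌈ u /2⌉ → weight u (suc j) ≤ weight u j
weight-antitone {u} {j} j<⌈u/2⌉ = *-cancelˡ-≤ (suc j) (begin
  suc j * weight u (suc j)     ≤⟨ *-monoˡ-≤ (weight u (suc j)) (m+n≤o⇒m≤o∸n (suc j) j+j<u) ⟩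
  (u ∸ j) * weight u (suc j)   ≡⟨ [n-k]*d[k+1]≡[k+1]*d[k] (m+n≤o⇒m≤o (suc j) j+j<u) ⟩
  suc j * weight u j           ∎)
  where
  j+j<u : suc j + j ≤ u
  j+j<u = begin
    suc j + j               ≤⟨ +-mono-≤ j<⌈u/2⌉ (s≤s⁻¹ (≤-trans j<⌈u/2⌉ (⌈n/2⌉≤1+⌊n/2⌋ u))) ⟩
    ⌈ u /2⌉ + ⌊ u /2⌋       ≡⟨ +-comm ⌈ u /2⌉ ⌊ u /2⌋ ⟩
    ⌊ u /2⌋ + ⌈ u /2⌉       ≡⟨ ⌊n/2⌋+⌈n/2⌉≡n u ⟩
    u                       ∎

weight-monotone : ∀ {u j} → ⌈ u /2⌉ ≤ j → j < u → weight u j ≤ weight u (suc j)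
weight-monotone {u} {j} ⌈u/2⌉≤j j<u = *-cancelˡ-≤ (suc j) (begin
  suc j * weight u j           ≡⟨ [n-k]*d[k+1]≡[k+1]*d[k] j<u ⟨
  (u ∸ j) * weight u (suc j)   ≤⟨ *-monoˡ-≤ (weight u (suc j)) (m≤n+o⇒m∸n≤o u j u≤j+j+1) ⟩
  suc j * weight u (suc j)     ∎)
  where
  u≤j+j+1 : u ≤ j + suc j
  u≤j+j+1 = begin
    u                   ≡⟨ ⌊n/2⌋+⌈n/2⌉≡n u ⟨
    ⌊ u /2⌋ + ⌈ u /2⌉   ≤⟨ +-mono-≤ (≤-trans (⌊n/2⌋≤⌈n/2⌉ u) ⌈u/2⌉≤j) (≤-trans ⌈u/2⌉≤j (n≤1+n j)) ⟩
    j + suc j           ∎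

weight-minimal : ∀ {u j} → j ≤ u → weight u ⌈ u /2⌉ ≤ weight u j
weight-minimal {u} {j} j≤u with ≤-total j ⌈ u /2⌉
... | inj₁ j≤⌈u/2⌉ = antitone-below (weight u) weight-antitone (≤⇒≤′ j≤⌈u/2⌉)
... | inj₂ ⌈u/2⌉≤j = monotone-above (weight u) weight-monotone (≤⇒≤′ ⌈u/2⌉≤j) j≤u

-- Only the members a with sel a ≡ true belong to the family; distinct members are
-- incomparable and in particular distinct sets.
Antichain : ∀ {m K} → (Fin m → Bool) → (Fin m → Subset K) → Set
Antichain sel S = ∀ {a b} → sel a ≡ true → sel b ≡ true → S a ⊆ S b → a ≡ b

weight-suc-∖ : ∀ {K u} {A U : Subset K} → A ⊆ U → ∣ U ∣ ≡ suc u → ∣ A ∣ ≤ u →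
               weight (suc u) ∣ A ∣ ≡ ∣ U ∖ A ∣ * weight u ∣ A ∣
weight-suc-∖ {u = u} {A} {U} A⊆U ∣U∣≡1+u ∣A∣≤u = trans (weight-suc ∣A∣≤u) (cong (_* _) 1+u∸∣A∣≡∣U∖A∣)
  where
  1+u∸∣A∣≡∣U∖A∣ : suc u ∸ ∣ A ∣ ≡ ∣ U ∖ A ∣
  1+u∸∣A∣≡∣U∖A∣ = trans (cong (_∸ ∣ A ∣) (trans (sym ∣U∣≡1+u) (∣∣-diff A⊆U))) (m+n∸m≡n ∣ A ∣ ∣ U ∖ A ∣)

Antichain-mono : ∀ {m K} {sel sel′ : Fin m → Bool} {S : Fin m → Subset K} →
                 (∀ {a} → sel′ a ≡ true → sel a ≡ true) → Antichain sel S → Antichain sel′ S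
Antichain-mono sel′⇒sel antichain p q = antichain (sel′⇒sel p) (sel′⇒sel q)

lym : ∀ {K m} u (U : Subset K) → ∣ U ∣ ≡ u → (sel : Fin m → Bool) (S : Fin m → Subset K) →
      (∀ {a} → sel a ≡ true → S a ⊆ U) → Antichain sel S →
      ∑[ a < m ] (⟦ sel a ⟧ * weight u ∣ S a ∣) ≤ u !
lym zero U ∣U∣≡0 sel S S⊆U antichain =
  sum-≤-at-most-one sel _ (λ p q → antichain p q (λ x x∈Sa → ⊥-elim (empty (S⊆U p x x∈Sa))))
                          (λ p → weight≤factorial (≤-trans (∣∣-mono (S⊆U p)) (≤-reflexive ∣U∣≡0)))
  where
  empty : ∀ {x} → U x ≡ true → ⊥
  empty Ux = n≮0 (≤-trans (∈⇒∣∣>0 {P = U} Ux) (≤-reflexive ∣U∣≡0))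
lym {K} {m} (suc u) U ∣U∣≡1+u sel S S⊆U antichain
  with any? (λ a → (sel a Bool.≟ true) ×-dec (∣ S a ∣ ℕ.≟ suc u))
... | yes (a₀ , sel₀ , ∣Sa₀∣≡1+u) =
  sum-≤-at-most-one sel _ (λ p q → trans (≡a₀ p) (sym (≡a₀ q)))
                          (λ p → weight≤factorial (≤-trans (∣∣-mono (S⊆U p)) (≤-reflexive ∣U∣≡1+u)))
  where
  U⊆Sa₀ : U ⊆ S a₀
  U⊆Sa₀ = ⊆∧∣∣≤⇒⊇ (S⊆U sel₀) (≤-reflexive (trans ∣U∣≡1+u (sym ∣Sa₀∣≡1+u)))
  ≡a₀ : ∀ {a} → sel a ≡ true → a ≡ a₀
  ≡a₀ p = antichain p sel₀ (λ x → U⊆Sa₀ x ∘ S⊆U p x)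
... | no ¬full = begin
  ∑[ a < m ] (⟦ sel a ⟧ * weight (suc u) ∣ S a ∣) ≡⟨ sum-cong-≗ spread ⟩
  ∑[ a < m ] ∑[ x < K ] share a x                ≡⟨ ∑-comm share ⟩
  ∑[ x < K ] ∑[ a < m ] share a x                ≤⟨ sum-mono shares-of ⟩
  ∑[ x < K ] (⟦ U x ⟧ * u !)                      ≡⟨ *-distribʳ-sum (u !) (⟦_⟧ ∘ U) ⟨
  ∣ U ∣ * u !                                     ≡⟨ cong (_* u !) ∣U∣≡1+u ⟩
  suc u !                                         ∎
  where
  -- The weight of a member A is spread over the elements x of U ∖ A; for a fixed x
  -- the members avoiding x form an antichain in U ∖ ⁅ x ⁆, where induction applies.
  share : Fin m → Fin K → ℕ
  share a x = ⟦ sel a ⟧ * (⟦ U x ∧ not (S a x) ⟧ * weight u ∣ S a ∣)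
  ∣S∣≤u : ∀ {a} → sel a ≡ true → ∣ S a ∣ ≤ u
  ∣S∣≤u p = s≤s⁻¹ (≤∧≢⇒< (≤-trans (∣∣-mono (S⊆U p)) (≤-reflexive ∣U∣≡1+u)) (λ e → ¬full (_ , p , e)))
  spread : ∀ a → ⟦ sel a ⟧ * weight (suc u) ∣ S a ∣ ≡ ∑[ x < K ] share a x
  spread a with sel a in p
  ... | false = sym (sum-replicate-zero K)
  ... | true  = trans (cong (1 *_) (trans (weight-suc-∖ (S⊆U p) ∣U∣≡1+u (∣S∣≤u p))
                                          (*-distribʳ-sum _ (⟦_⟧ ∘ (U ∖ S a)))))
                      (*-distribˡ-sum 1 (λ x → ⟦ U x ∧ not (S a x) ⟧ * weight u ∣ S a ∣))
  shares-of : ∀ x → ∑[ a < m ] (⟦ sel a ⟧ * (⟦ U x ∧ not (S a x) ⟧ * weight u ∣ S a ∣)) ≤ ⟦ U x ⟧ * u !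
  shares-of x with U x in Ux
  ... | false = ≤-reflexive (sum-zero (λ a → *-zeroʳ ⟦ sel a ⟧))
  ... | true  = begin
    ∑[ a < m ] (⟦ sel a ⟧ * (⟦ not (S a x) ⟧ * weight u ∣ S a ∣)) ≡⟨ sum-cong-≗ (λ a → regroup (sel a) (not (S a x)) _) ⟩
    ∑[ a < m ] (⟦ sel a ∧ not (S a x) ⟧ * weight u ∣ S a ∣)       ≤⟨ lym u (U ∖ ⁅ x ⁆) ∣U∖x∣≡u _ S avoiding-⊆ avoiding-antichain ⟩
    u !                                                        ≤⟨ m≤m+n (u !) 0 ⟩
    u ! + 0                                                    ∎
    where
    ∣U∖x∣≡u : ∣ U ∖ ⁅ x ⁆ ∣ ≡ u
    ∣U∖x∣≡u = ℕ.suc-injective (trans (sym (∣∣-remove {P = U} Ux)) ∣U∣≡1+u)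
    avoiding-⊆ : ∀ {a} → sel a ∧ not (S a x) ≡ true → S a ⊆ U ∖ ⁅ x ⁆
    avoiding-⊆ {a} p = ⊆∖⁅⁆ (S⊆U (∧-elimˡ (sel a) p)) (∧-elimʳ (sel a) p)
    avoiding-antichain : Antichain (λ a → sel a ∧ not (S a x)) S
    avoiding-antichain = Antichain-mono (λ {a} → ∧-elimˡ (sel a)) antichain
    regroup : ∀ a b w → ⟦ a ⟧ * (⟦ b ⟧ * w) ≡ ⟦ a ∧ b ⟧ * w
    regroup a b w = trans (sym (*-assoc ⟦ a ⟧ ⟦ b ⟧ w)) (cong (_* w) (sym (⟦∧⟧ a b)))

sperner : ∀ {K m} (U : Subset K) (S : Fin m → Subset K) → (∀ a → S a ⊆ U) →
          (∀ {a b} → S a ⊆ S b → a ≡ b) → m ≤ ∣ U ∣ C ⌈ ∣ U ∣ /2⌉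
sperner {K} {m} U S S⊆U antichain = *-cancelʳ-≤ m (u C h) (weight u h) {{h !* (u ∸ h) !≢0}} (begin
  m * weight u h                    ≡⟨ sum-const m (weight u h) ⟨
  ∑[ a < m ] weight u h             ≤⟨ sum-mono (λ a → weight-minimal (∣∣-mono (S⊆U a))) ⟩
  ∑[ a < m ] weight u ∣ S a ∣       ≡⟨ sum-cong-≗ (λ a → *-identityˡ (weight u ∣ S a ∣)) ⟨
  ∑[ a < m ] (1 * weight u ∣ S a ∣) ≤⟨ lym u U refl (λ _ → true) S (λ _ → S⊆U _) (λ _ _ → antichain) ⟩
  u !                               ≡⟨ factorial≡C*weight (⌈n/2⌉≤n u) ⟩
  (u C h) * weight u h              ∎)
  where
  u h : ℕ
  u = ∣ U ∣
  h = ⌈ u /2⌉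

IsSigma⇒≤ : ∀ {m s k} → IsSigma m s → m ≤ k C ⌈ k /2⌉ → s ≤ k
IsSigma⇒≤ {k = k} (_ , below) m≤C = ≮⇒≥ (λ k<s → <⇒≱ (below k k<s) m≤C)

⊗-combine : ∀ {r₁ c₁ r₂ c₂} (A : Matrix r₁ c₁) (B : Matrix r₂ c₂) i a j b →
            (A ⊗ B) (combine i a) (combine j b) ≡ A i j ∧ B a b
⊗-combine {r₁} {c₁} {r₂} {c₂} A B i a j b =
  cong₂ (λ p q → A (proj₁ p) (proj₁ q) ∧ B (proj₂ p) (proj₂ q))
        (remQuot-combine {r₁} {r₂} i a) (remQuot-combine {c₁} {c₂} j b)

Cmat-diag : ∀ {n} (i : Fin n) → Cmat n i i ≡ false
Cmat-diag i = cong not (⌊⌋-true (i ≟ i) refl)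

∣Cmat-row∣ : ∀ {n} (i : Fin n) → ∣ Cmat n i ∣ ≡ n ∸ 1
∣Cmat-row∣ {n} i = sym (cong (_∸ 1) (trans (sym ∣⊤∣≡n) (∣∣-remove {P = λ _ → true} {i} refl)))
  where
  ∣⊤∣≡n : ∣ (λ (_ : Fin n) → true) ∣ ≡ n
  ∣⊤∣≡n = trans (sum-const n 1) (*-identityʳ n)

∑∑Cmat*s≡n*[n∸1]*s : ∀ n s → ∑[ i < n ] ∑[ j < n ] (⟦ Cmat n i j ⟧ * s) ≡ n * (n ∸ 1) * s
∑∑Cmat*s≡n*[n∸1]*s n s = begin-equality
  ∑[ i < n ] ∑[ j < n ] (⟦ Cmat n i j ⟧ * s) ≡⟨ sum-cong-≗ (λ i → *-distribʳ-sum s (⟦_⟧ ∘ Cmat n i)) ⟨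
  ∑[ i < n ] (∣ Cmat n i ∣ * s)              ≡⟨ sum-cong-≗ (λ i → cong (_* s) (∣Cmat-row∣ {n} i)) ⟩
  ∑[ i < n ] ((n ∸ 1) * s)                   ≡⟨ sum-const n _ ⟩
  n * ((n ∸ 1) * s)                          ≡⟨ *-assoc n (n ∸ 1) s ⟨
  n * (n ∸ 1) * s                            ∎

module Blocks (n m : ℕ) {k} (cover : Cover (Cmat n ⊗ Cmat m) k) where
  open Cover cover

  blockRows blockCols : Fin k → Subset n
  blockRows t i = ⌊ any? (λ (a : Fin m) → rows (rect-of t) (combine i a) Bool.≟ true) ⌋
  blockCols t j = ⌊ any? (λ (b : Fin m) → cols (rect-of t) (combine j b) Bool.≟ true) ⌋

  blocks-disjoint : ∀ t i → blockRows t i ≡ true → blockCols t i ≡ true → ⊥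
  blocks-disjoint t i rᵢ cᵢ with witness (any? _) rᵢ | witness (any? _) cᵢ
  ... | a , ra | b , cb = true≢false (trans (sym (all-ones t _ _ ra cb))
                                            (trans (⊗-combine (Cmat n) (Cmat m) i a i b) (cong (_∧ Cmat m a b) (Cmat-diag i))))

  meets : Fin n → Fin n → Subset k
  meets i j t = blockRows t i ∧ blockCols t j

  blocks-met≤ : ∀ t → ∑[ i < n ] ∑[ j < n ] ⟦ meets i j t ⟧ ≤ ⌈ n /2⌉ * ⌊ n /2⌋
  blocks-met≤ t = ≤-trans (≤-reflexive (∑∑⟦∧⟧≡∣∣*∣∣ (blockRows t) (blockCols t)))
                          (x+y≤n⇒x*y≤⌈n/2⌉*⌊n/2⌋ n {∣ blockRows t ∣} (∣∣+∣∣≤n (blocks-disjoint t)))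

  σ≤∣meets∣ : ∀ {s} → IsSigma m s → ∀ {i j} → Cmat n i j ≡ true → s ≤ ∣ meets i j ∣
  σ≤∣meets∣ σ {i} {j} Cᵢⱼ = IsSigma⇒≤ σ (sperner (meets i j) S S⊆meets antichain)
    where
    S : Fin m → Subset k
    S a t = rows (rect-of t) (combine i a) ∧ blockCols t j
    S⊆meets : ∀ a → S a ⊆ meets i j
    S⊆meets a t p = ∧-intro (⌊⌋-true (any? _) (a , ∧-elimˡ _ p)) (∧-elimʳ (rows (rect-of t) (combine i a)) p)
    antichain : ∀ {a b} → S a ⊆ S b → a ≡ b
    antichain {a} {b} Sa⊆Sb with a ≟ b
    ... | yes a≡b = a≡b
    ... | no  a≢b with covers (combine i a) (combine j b)
                              (trans (⊗-combine (Cmat n) (Cmat m) i a j b)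
                                     (cong₂ _∧_ Cᵢⱼ (cong not (⌊⌋-false (a ≟ b) a≢b))))
    ... | t , ra , cb = ⊥-elim (true≢false (trans (sym (all-ones t _ _ rb cb))
                                              (trans (⊗-combine (Cmat n) (Cmat m) i b j b) (cong₂ _∧_ Cᵢⱼ (Cmat-diag b)))))
      where
      rb : rows (rect-of t) (combine i b) ≡ true
      rb = ∧-elimˡ _ (Sa⊆Sb t (∧-intro ra (⌊⌋-true (any? _) (b , cb))))

corollary3 : (n m : ℕ) → 2 ≤ n → 1 ≤ m → (s : ℕ) → IsSigma m s →
             (k : ℕ) → Cover (Cmat n ⊗ Cmat m) k →
             n * (n ∸ 1) * s ≤ k * (⌈ n /2⌉ * ⌊ n /2⌋)
corollary3 n m _ _ s σ k cover = begin
  n * (n ∸ 1) * s                                  ≡⟨ ∑∑Cmat*s≡n*[n∸1]*s n s ⟨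
  ∑[ i < n ] ∑[ j < n ] (⟦ Cmat n i j ⟧ * s)       ≤⟨ sum-mono (λ i → sum-mono (per-block i)) ⟩
  ∑[ i < n ] ∑[ j < n ] ∣ meets i j ∣              ≡⟨ sum-cong-≗ (λ i → ∑-comm {n} {k} (λ j t → ⟦ meets i j t ⟧)) ⟩
  ∑[ i < n ] ∑[ t < k ] ∑[ j < n ] ⟦ meets i j t ⟧ ≡⟨ ∑-comm {n} {k} (λ i t → ∑[ j < n ] ⟦ meets i j t ⟧) ⟩
  ∑[ t < k ] ∑[ i < n ] ∑[ j < n ] ⟦ meets i j t ⟧ ≤⟨ sum-mono blocks-met≤ ⟩
  ∑[ t < k ] (⌈ n /2⌉ * ⌊ n /2⌋)                   ≡⟨ sum-const k _ ⟩
  k * (⌈ n /2⌉ * ⌊ n /2⌋)                          ∎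
  where
  open Blocks n m cover
  per-block : ∀ i j → ⟦ Cmat n i j ⟧ * s ≤ ∣ meets i j ∣
  per-block i j with Cmat n i j in Cᵢⱼ
  ... | false = z≤n
  ... | true  = ≤-trans (≤-reflexive (+-identityʳ s)) (σ≤∣meets∣ σ Cᵢⱼ)
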